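{- Let $G$ be a finite abelian group and let $J\subset G$ with $0\in J$. Suppose there exist $g\in G$ and a positive integer $m$ such that the order of $g$ is at least $m+1$ and $\{ -mg,-(m-1)g,\ldots,mg\}\subset J$. Then for every positive integer $N$, $$D_G(J,N)\le\Big(\frac{|G|}{m+1}\Big)^N.$$ In particular, if $0\in J\subset G$ and $J\cap(-J)\ne\{0\}$, then $D_G(J,N)\le (|G|/2)^N$ for every positive integer $N$.
   Context: For a finite abelian group $G$ (written additively), a subset $J\subset G$ with $0\in J$, and a positive integer $N$, $D_G(J,N)$ denotes the maximum size of a set $A\subset G^N$ such that $(A-A)\cap J^N=\{\mathbf{0}\}$, where $G^N,J^N$ are $N$-fold Cartesian products. -}

module Defs where

open import Level using (0ℓ)
open import Data.Nat using (ℕ; zero; suc; _*_; _^_; _≤_; _<_)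
open import Data.Fin using (Fin)
open import Data.List using (List; length)
open import Data.List.Membership.Propositional using (_∈_)
open import Data.List.Relation.Unary.AllPairs using (AllPairs)
open import Data.Product using (_×_; Σ)
open import Relation.Nullary using (¬_)
open import Relation.Unary using (Pred)
open import Relation.Binary.PropositionalEquality as ≡ using ()
open import Function.Bundles using (Inverse)
open import Algebra.Bundles using (AbelianGroup)
import Algebra.Definitions.RawMonoid as RawMonoidDefs

-- A finite abelian group (written additively: _∙_ is +, ε is 0, _⁻¹ is negation)
-- of cardinality n: the carrier setoid is in bijection with Fin n.
record FiniteAbelianGroup : Set₁ where
  field
    abGroup : AbelianGroup 0ℓ 0ℓ
    size  : ℕ
  open AbelianGroup abGroup public
  field
    enum  : Inverse (≡.setoid (Fin size)) setoid

module _ (G : FiniteAbelianGroup) where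
  open FiniteAbelianGroup G

  _·_ : ℕ → Carrier → Carrier
  k · g = RawMonoidDefs._×_ rawMonoid k g

  _⊖_ : Carrier → Carrier → Carrier
  x ⊖ y = x ∙ (y ⁻¹)

  -- "the order of g is at least m+1": k·g ≠ 0 for every 1 ≤ k ≤ m
  OrderAtLeast : Carrier → ℕ → Set
  OrderAtLeast g r = ∀ k → 1 ≤ k → k < r → ¬ ((k · g) ≈ ε)

  Tuple : ℕ → Set
  Tuple N = Fin N → Carrier

  _≈ᴺ_ : ∀ {N} → Tuple N → Tuple N → Set
  a ≈ᴺ b = ∀ i → a i ≈ b i

  -- a finite set A ⊆ G^N, given as a duplicate-free list
  DistinctList : ∀ N → List (Tuple N) → Set
  DistinctList N A = AllPairs (λ a b → ¬ (a ≈ᴺ b)) A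

  -- (A - A) ∩ J^N = {0}  (with 0 ∈ J, 0 always lies in this intersection
  -- when A ≠ ∅; the condition says no other difference lies in J^N)
  Avoids : (J : Pred Carrier 0ℓ) → ∀ N → List (Tuple N) → Set
  Avoids J N A = ∀ a b → a ∈ A → b ∈ A →
                 (∀ i → J (a i ⊖ b i)) → (∀ i → a i ⊖ b i ≈ ε)

  -- the sets competing in the definition of D_G(J,N)
  Admissible : (J : Pred Carrier 0ℓ) → ∀ N → List (Tuple N) → Set
  Admissible J N A = DistinctList N A × Avoids J N A

  -- D_G(J,N) ≤ (|G|/q)^N, i.e. every admissible A has |A| * q^N ≤ |G|^N
  DBound : (J : Pred Carrier 0ℓ) → ℕ → ℕ → Set
  DBound J N q = ∀ A → Admissible J N A → length A * q ^ N ≤ size ^ N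

-- Let S = {0, g, 2g, …, mg}, a set of m + 1 distinct elements with S − S ⊆ J.
-- For an admissible A ⊆ G^N the translates a + S^N (a ∈ A) are pairwise
-- disjoint: a + p = b + q forces a − b = q − p ∈ J^N, hence a = b and p = q.
-- So |A| · (m + 1)^N ≤ |G|^N. The second claim is the case m = 1, g = x.
module Submission where

open import Defs
open import Level using (0ℓ)
open import Data.Nat using (ℕ; zero; suc; _≤_; _<_; _+_; _∸_; _^_; s≤s)
open import Data.Nat.Properties
  using (m+[n∸m]≡n; m∸n≤m; ≤-total; <-cmp; ≤-trans; <⇒≤; m<n⇒0<n∸m; ≤-pred)
open import Data.Product using (_×_; Σ; _,_; proj₁; proj₂)
open import Data.Sum using (inj₁; inj₂)
open import Data.Empty using (⊥-elim)
open import Data.Fin using (Fin; toℕ; combine; remQuot; finToFun; funToFin)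
  renaming (zero to fzero; suc to fsuc)
open import Data.Fin.Properties
  using (toℕ-injective; toℕ<n; injective⇒≤; *↔×; finToFun-funToFin; funToFin-finToFin)
open import Data.List using (length; lookup)
open import Data.List.Membership.Propositional.Properties using (∈-lookup)
import Data.List.Relation.Unary.All as All
open import Data.List.Relation.Unary.AllPairs using (_∷_)
import Data.List.Relation.Unary.Unique.Setoid as UniqueSetoid
import Data.Vec.Functional.Relation.Binary.Pointwise.Properties as Pointwise
open import Function using (_∘_)
open import Function.Bundles using (Inverse; Injection)
open import Function.Properties.Inverse using (Inverse⇒Injection)
import Function.Construct.Symmetry as Symmetry
open import Relation.Nullary using (¬_)
open import Relation.Unary using (Pred)
open import Relation.Binary.Bundles using (Setoid)
open import Relation.Binary.Definitions using (_Respects_; tri<; tri≈; tri>)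
open import Relation.Binary.PropositionalEquality as ≡ using (_≡_; _≗_)
import Algebra.Properties.AbelianGroup as AbelianGroupProperties
import Algebra.Properties.Monoid.Mult as MultProperties
import Relation.Binary.Reasoning.Setoid as SetoidReasoning

funToFin-cong : ∀ {m n} {f g : Fin m → Fin n} → f ≗ g → funToFin f ≡ funToFin g
funToFin-cong {zero}  f≗g = ≡.refl
funToFin-cong {suc m} f≗g =
  ≡.cong₂ combine (f≗g fzero) (funToFin-cong (f≗g ∘ fsuc))

finToFun-injective : ∀ {m n} {x y : Fin (m ^ n)} → finToFun {m} {n} x ≗ finToFun y → x ≡ y
finToFun-injective {m} {n} {x} {y} eq =
  ≡.trans (≡.sym (funToFin-finToFin {n} {m} x))
          (≡.trans (funToFin-cong {n} {m} eq) (funToFin-finToFin {n} {m} y))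

module _ {a ℓ} (S : Setoid a ℓ) where
  open Setoid S
  open UniqueSetoid S using (Unique)

  Unique-lookup-injective : ∀ {xs} → Unique xs → ∀ i j → lookup xs i ≈ lookup xs j → i ≡ j
  Unique-lookup-injective (_  ∷ _)   fzero    fzero    _  = ≡.refl
  Unique-lookup-injective (px ∷ _)   fzero    (fsuc j) eq = ⊥-elim (All.lookup px (∈-lookup j) eq)
  Unique-lookup-injective (px ∷ _)   (fsuc i) fzero    eq = ⊥-elim (All.lookup px (∈-lookup i) (sym eq))
  Unique-lookup-injective (_  ∷ xs!) (fsuc i) (fsuc j) eq =
    ≡.cong fsuc (Unique-lookup-injective xs! i j eq)

  pointwise-injective⇒≤ : ∀ {n k} N → Inverse (≡.setoid (Fin n)) S →
    (f : Fin k → Fin N → Carrier) → (∀ x y → (∀ i → f x i ≈ f y i) → x ≡ y) → k ≤ n ^ N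
  pointwise-injective⇒≤ N enum f f-inj = injective⇒≤ {f = encode} encode-injective
    where
    open Inverse enum using (from)
    from-injective : ∀ {u v} → from u ≡ from v → u ≈ v
    from-injective = Injection.injective (Inverse⇒Injection (Symmetry.inverse enum))
    encode : _ → Fin (_ ^ N)
    encode x = funToFin (from ∘ f x)
    encode-injective : ∀ {x y} → encode x ≡ encode y → x ≡ y
    encode-injective {x} {y} eq = f-inj x y λ i → from-injective (begin
      from (f x i)                 ≡⟨ finToFun-funToFin (from ∘ f x) i ⟨
      finToFun (encode x) i        ≡⟨ ≡.cong (λ z → finToFun z i) eq ⟩
      finToFun (encode y) i        ≡⟨ finToFun-funToFin (from ∘ f y) i ⟩
      from (f y i)                 ∎)
      where open ≡.≡-Reasoning

module _ (G : FiniteAbelianGroup) where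
  open FiniteAbelianGroup G
  open AbelianGroupProperties abGroup
    using (x∙y⁻¹≈ε⇒x≈y; x≈y⇒x∙y⁻¹≈ε; ⁻¹-anti-homo-//; ∙-cancelˡ; //-rightDividesʳ; xyx⁻¹≈y)
  open MultProperties monoid using (×-homo-+)
  open SetoidReasoning setoid

  ∙≈∙⇒//≈// : ∀ {a b p q} → a ∙ p ≈ b ∙ q → a ∙ b ⁻¹ ≈ q ∙ p ⁻¹
  ∙≈∙⇒//≈// {a} {b} {p} {q} eq = begin
    a ∙ b ⁻¹                  ≈⟨ ∙-congʳ (//-rightDividesʳ p a) ⟨
    (a ∙ p) ∙ p ⁻¹ ∙ b ⁻¹     ≈⟨ ∙-congʳ (∙-congʳ eq) ⟩
    (b ∙ q) ∙ p ⁻¹ ∙ b ⁻¹     ≈⟨ ∙-congʳ (assoc b q (p ⁻¹)) ⟩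
    b ∙ (q ∙ p ⁻¹) ∙ b ⁻¹     ≈⟨ xyx⁻¹≈y b (q ∙ p ⁻¹) ⟩
    q ∙ p ⁻¹                  ∎

  difference-set⇒DBound : (J : Pred Carrier 0ℓ) → J Respects _≈_ → ∀ {q} (s : Fin q → Carrier) →
    (∀ x y → s x ≈ s y → x ≡ y) → (∀ x y → J (s y ∙ s x ⁻¹)) → ∀ N → DBound G J N q
  difference-set⇒DBound J J-resp {q} s s-inj s-diff N A (A! , A-avoids) =
    pointwise-injective⇒≤ setoid N enum (translate ∘ remQuot (q ^ N)) translate-injective
    where
    translate : Fin (length A) × Fin (q ^ N) → Tuple G N
    translate (j , t) i = lookup A j i ∙ s (finToFun t i)

    translate-injective : ∀ x y → (∀ i → translate (remQuot _ x) i ≈ translate (remQuot _ y) i) → x ≡ y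
    translate-injective x y eq = Injection.injective (Inverse⇒Injection (*↔× {length A}))
      (≡.cong₂ _,_ j≡j′ (finToFun-injective {q} {N} t≗t′))
      where
      j = proj₁ (remQuot {length A} (q ^ N) x)
      j′ = proj₁ (remQuot {length A} (q ^ N) y)
      t = proj₂ (remQuot {length A} (q ^ N) x)
      t′ = proj₂ (remQuot {length A} (q ^ N) y)
      a = lookup A j
      b = lookup A j′
      a−b∈J : ∀ i → J (a i ∙ b i ⁻¹)
      a−b∈J i = J-resp (sym (∙≈∙⇒//≈// (eq i))) (s-diff _ _)
      a≈b : ∀ i → a i ≈ b i
      a≈b i = x∙y⁻¹≈ε⇒x≈y _ _ (A-avoids a b (∈-lookup j) (∈-lookup j′) a−b∈J i)
      j≡j′ : j ≡ j′
      j≡j′ = Unique-lookup-injective (Pointwise.setoid setoid N) A! j j′ a≈b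
      t≗t′ : finToFun t ≗ finToFun t′
      t≗t′ i = s-inj _ _ (∙-cancelˡ (a i) _ _ (trans (eq i) (∙-congʳ (sym (a≈b i)))))

  module _ (g : Carrier) where
    infix 8 _·g
    _·g : ℕ → Carrier
    k ·g = _·_ G k g

    ·-∸ : ∀ {k l} → k ≤ l → (l ∸ k) ·g ≈ l ·g ∙ (k ·g) ⁻¹
    ·-∸ {k} {l} k≤l = begin
      (l ∸ k) ·g                      ≈⟨ xyx⁻¹≈y (k ·g) ((l ∸ k) ·g) ⟨
      k ·g ∙ (l ∸ k) ·g ∙ (k ·g) ⁻¹   ≈⟨ ∙-congʳ (×-homo-+ g k (l ∸ k)) ⟨
      (k + (l ∸ k)) ·g ∙ (k ·g) ⁻¹    ≡⟨ ≡.cong (λ n → n ·g ∙ (k ·g) ⁻¹) (m+[n∸m]≡n k≤l) ⟩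
      l ·g ∙ (k ·g) ⁻¹                ∎

    multiples-distinct : ∀ {r k l} → OrderAtLeast G g r → k < l → l < r → ¬ (k ·g ≈ l ·g)
    multiples-distinct {k = k} {l} ord k<l l<r eq =
      ord (l ∸ k) (m<n⇒0<n∸m k<l) (≤-trans (s≤s (m∸n≤m l k)) l<r)
        (trans (·-∸ (<⇒≤ k<l)) (x≈y⇒x∙y⁻¹≈ε (sym eq)))

    multiples-injective : ∀ {r k l} → OrderAtLeast G g r → k < r → l < r →
      k ·g ≈ l ·g → k ≡ l
    multiples-injective {k = k} {l} ord k<r l<r eq with <-cmp k l
    ... | tri< k<l _ _ = ⊥-elim (multiples-distinct ord k<l l<r eq)
    ... | tri≈ _ k≡l _ = k≡l
    ... | tri> _ _ l<k = ⊥-elim (multiples-distinct ord l<k k<r (sym eq))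

    multiples-difference : ∀ {J : Pred Carrier 0ℓ} → J Respects _≈_ → ∀ {m} →
      (∀ k → k ≤ m → J ((k ·g) ⁻¹) × J (k ·g)) →
      ∀ {k l} → k ≤ m → l ≤ m → J (l ·g ∙ (k ·g) ⁻¹)
    multiples-difference J-resp ±kg∈J {k} {l} k≤m l≤m with ≤-total k l
    ... | inj₁ k≤l = J-resp (·-∸ k≤l) (proj₂ (±kg∈J (l ∸ k) (≤-trans (m∸n≤m l k) l≤m)))
    ... | inj₂ l≤k = J-resp (trans (⁻¹-cong (·-∸ l≤k)) (⁻¹-anti-homo-// _ _))
                            (proj₁ (±kg∈J (k ∸ l) (≤-trans (m∸n≤m k l) k≤m)))

    progression⇒DBound : (J : Pred Carrier 0ℓ) → J Respects _≈_ → ∀ m → OrderAtLeast G g (suc m) →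
      (∀ k → k ≤ m → J ((k ·g) ⁻¹) × J (k ·g)) → ∀ N → DBound G J N (suc m)
    progression⇒DBound J J-resp m ord ±kg∈J = difference-set⇒DBound J J-resp (λ k → toℕ k ·g)
      (λ x y eq → toℕ-injective (multiples-injective ord (toℕ<n x) (toℕ<n y) eq))
      (λ x y → multiples-difference J-resp ±kg∈J (≤-pred (toℕ<n x)) (≤-pred (toℕ<n y)))

proposition2p10 : (G : FiniteAbelianGroup) → let open FiniteAbelianGroup G in
    (J : Pred Carrier 0ℓ) → J Respects _≈_ → J ε →
    ((g : Carrier) (m : ℕ) → 1 ≤ m → OrderAtLeast G g (suc m) →
       (∀ k → k ≤ m → J ((_·_ G k g) ⁻¹) × J (_·_ G k g)) →
       ∀ N → 1 ≤ N → DBound G J N (suc m))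
    ×
    ((Σ Carrier λ x → J x × J (x ⁻¹) × ¬ (x ≈ ε)) →
       ∀ N → 1 ≤ N → DBound G J N 2)
proposition2p10 G J J-resp 0∈J =
    (λ g m _ ord ±kg∈J N _ → progression⇒DBound G g J J-resp m ord ±kg∈J N)
  , λ (x , x∈J , -x∈J , x≉0) N _ → progression⇒DBound G x J J-resp 1 (order≥2 x≉0) (±x∈J x∈J -x∈J) N
  where
  open FiniteAbelianGroup G
  open AbelianGroupProperties abGroup using (ε⁻¹≈ε)

  order≥2 : ∀ {x} → ¬ (x ≈ ε) → OrderAtLeast G x 2
  order≥2 x≉0 1 _ _ x≈0 = x≉0 (trans (sym (identityʳ _)) x≈0)
  order≥2 x≉0 (suc (suc _)) _ (s≤s (s≤s ()))

  ±x∈J : ∀ {x} → J x → J (x ⁻¹) → ∀ k → k ≤ 1 → J ((_·_ G k x) ⁻¹) × J (_·_ G k x)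
  ±x∈J _   _    0 _ = J-resp (sym ε⁻¹≈ε) 0∈J , 0∈J
  ±x∈J x∈J -x∈J 1 _ = J-resp (⁻¹-cong (sym (identityʳ _))) -x∈J , J-resp (sym (identityʳ _)) x∈J
  ±x∈J _   _    (suc (suc _)) (s≤s ())
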